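{- Let $u\in A^*$ with $|N(u,A)|=1$. Then \[\Big(\sum_{v\in A}\mathrm{contr}(u,v)-2\,\mathrm{charge}(u,n(u))\Big)w(n(u))\geq 2\xi\, w(n(u))\, w(\mathrm{supp}(u)).\]
   Context: Let $k\geq 4$ be an integer and $G=(V,E)$ a finite simple $(k+1)$-claw free graph (no vertex has $k+1$ pairwise non-adjacent neighbors) with weights $w:V\to\mathbb{Q}_{>0}$; $w(X)=\sum_{x\in X}w(x)$, $w^2(X)=\sum_{x\in X}w(x)^2$. Let $A^*$ be a maximum-weight independent set and $A$ an independent set. $N(X,A)=(X\cap A)\cup\{a\in A: a\text{ adjacent to some }x\in X\}$, $N(u,A)=N(\{u\},A)$. An independent $X$ is a local improvement if $w^2(X)>w^2(N(X,A))$; it is claw-shaped if $|X|=1$ and $N(X,A)=\emptyset$, or some $v\in A$ is adjacent to all of $X$. Assume no claw-shaped improvement of $A$ exists (so $A$ is maximal). Fix $n(u)\in N(u,A)$ of maximum weight and, if $|N(u,A)|\geq2$, $n_2(u)\in N(u,A)\setminus\{n(u)\}$ of maximum weight. $\mathrm{contr}(u,v)=\max\{0,(w(u)^2-w^2(N(u,A)\setminus\{v\}))/w(v)\}$ if $v\in N(u,A)$, else $0$; $\mathrm{charge}(u,v)=w(u)-\frac12w(N(u,A))$ if $v=n(u)$, else $0$. Constants $\epsilon,\xi>0$ satisfy: $\frac38(1+\epsilon)^2+\epsilon^2\leq\frac{11}{16}(1+\epsilon)^2+\epsilon^2\leq\frac34(1+\epsilon)^2+\epsilon^2\leq1$; $\frac{1-\epsilon}{2}\geq\frac{1-\epsilon(1+\epsilon)}{2}\geq\frac{1-2\epsilon(1+\epsilon)}{2}\geq\xi$;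 $\big(1-\sqrt{\tfrac{5}{8(1-\epsilon^2)}}\big)^2/\big(1+\epsilon\sqrt{\tfrac{5}{8(1-\epsilon^2)}}\big)\geq 2\xi$; $\min\{\frac{\epsilon}{2+\epsilon},\frac14,\frac1{4(1+\epsilon)},\frac{\epsilon}{2(1+\epsilon)},\frac{\epsilon}{4+2\epsilon}\}\geq\frac{\epsilon}{4(2+\epsilon)}\geq\xi$; $\frac{\epsilon}{2(1+\epsilon)(2+\epsilon)}\geq\frac{\epsilon}{2(1+\epsilon)^2(2+\epsilon)}\geq\frac{\epsilon}{2(1+\epsilon)^3(2+\epsilon)}\geq\xi$; $\frac{(1/3-\epsilon)^2}{(4/3+2\epsilon)(2+\epsilon)}\geq\xi$; $\epsilon\big(\frac{2+(1+\epsilon)^{ -1}}{2+\epsilon}-(1+\epsilon)\big)\geq2\xi$. Helpful: $u\in N(v,V\setminus A)$ is helpful for $v\in A$ if either (a) $v=n(u)$, $w(n(u))\leq(1+\epsilon)w(u)$ and $w(N(u,A)\setminus\{n(u)\})\leq\epsilon w(u)$; or (b) $|N(u,A)|\geq2$, $v\in\{n(u),n_2(u)\}$, $(1+\epsilon)^{ -1}w(n(u))\leq w(n_2(u))\leq w(n(u))\leq(1+\epsilon)w(u)$ and $w(N(u,A)\setminus\{n(u),n_2(u)\})\leq\epsilon w(u)$. $\mathrm{help}(u)$ is the set of $v\in A$ that $u$ is helpful for. $u\in A^*$ and $v\in A$ are special neighbors if $v=n(u)$, $v\notin\mathrm{help}(u)$ and $\mathrm{contr}(u,v)>\frac58w(v)$.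 For $u\in A^*$, $\mathrm{supp}(u)=\{v\in N(u,A)\setminus\mathrm{help}(u): u\text{ and }v\text{ are not special neighbors}\}$. -}

module Defs where

open import Data.Nat as ℕ using (ℕ; zero; suc)
open import Data.Bool using (Bool; true; false; if_then_else_; _∧_; _∨_)
open import Data.Fin using (Fin; zero; suc)
import Data.Fin.Properties as FinP
open import Data.Fin.Subset using (Subset; _∈_; _∉_; ⁅_⁆; _∪_; _─_; ∣_∣; Empty) renaming (_-_ to _∖ₛ_)
open import Data.Fin.Subset.Properties using (_∈?_)
open import Data.Vec using (lookup; tabulate)
open import Data.Integer using (+_)
open import Data.Rational using (ℚ; 0ℚ; 1ℚ; ½; _+_; _*_; _-_; _÷_; _≤_; _<_; _⊔_; _/_)
open import Data.Rational.Properties using (_≤?_)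
open import Data.Rational using (≢-nonZero)
import Data.Rational.Properties as ℚP
open import Data.Product using (Σ; ∃; _×_; _,_)
open import Data.Sum using (_⊎_)
open import Function.Definitions using (Injective)
open import Relation.Binary.PropositionalEquality using (_≡_; _≢_)
open import Relation.Nullary using (¬_; Dec; yes; no)
open import Relation.Nullary.Decidable using (⌊_⌋; ¬?; _×-dec_; _⊎-dec_)

-- Total division on ℚ (x ÷ₜ 0 := 0); agrees with _÷_ on nonzero divisors.
-- Only ever applied to positive divisors below.

_÷ₜ_ : ℚ → ℚ → ℚ
p ÷ₜ q with q ℚP.≟ 0ℚ
... | yes _  = 0ℚ
... | no q≢0 = _÷_ p q {{≢-nonZero q≢0}}

sumFin : ∀ {n} → (Fin n → ℚ) → ℚ
sumFin {zero}  f = 0ℚ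
sumFin {suc n} f = f zero + sumFin (λ i → f (suc i))

anyFin : ∀ {n} → (Fin n → Bool) → Bool
anyFin {zero}  f = false
anyFin {suc n} f = f zero ∨ anyFin (λ i → f (suc i))

sumOver : ∀ {n} → Subset n → (Fin n → ℚ) → ℚ
sumOver X f = sumFin (λ i → if lookup X i then f i else 0ℚ)

record Graph (n : ℕ) : Set where
  field
    adj    : Fin n → Fin n → Bool
    sym    : ∀ x y → adj x y ≡ adj y x
    irrefl : ∀ x → adj x x ≡ false

module _ {n : ℕ} (G : Graph n) where
  open Graph G

  Independent : Subset n → Set
  Independent X = ∀ {x y} → x ∈ X → y ∈ X → adj x y ≡ false

  ClawFree : ℕ → Set
  ClawFree m = ¬ (Σ (Fin n) λ v → Σ (Fin m → Fin n) λ f →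
                    Injective _≡_ _≡_ f
                  × (∀ i → adj v (f i) ≡ true)
                  × (∀ i j → i ≢ j → adj (f i) (f j) ≡ false))

  -- N(X, A) = (X ∩ A) ∪ {a ∈ A : a adjacent to some x ∈ X}
  NS : Subset n → Subset n → Subset n
  NS X A = tabulate (λ a → lookup A a ∧ (lookup X a ∨ anyFin (λ x → lookup X x ∧ adj x a)))

module Weights {n : ℕ} (G : Graph n) (w : Fin n → ℚ) where
  open Graph G

  wS : Subset n → ℚ
  wS X = sumOver X w

  w² : Subset n → ℚ
  w² X = sumOver X (λ x → w x * w x)

  MaxWeightIndependent : Subset n → Set
  MaxWeightIndependent S = Independent G S × (∀ X → Independent G X → wS X ≤ wS S)

  ClawShapedImprovement : Subset n → Subset n → Set
  ClawShapedImprovement A X =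
      Independent G X
    × w² (NS G X A) < w² X
    × ((∣ X ∣ ≡ 1 × Empty (NS G X A))
       ⊎ Σ (Fin n) λ v → v ∈ A × (∀ {x} → x ∈ X → adj v x ≡ true))

  IsNChoice : Subset n → (Fin n → Fin n) → Set
  IsNChoice A nf = ∀ u → (Σ (Fin n) λ a → a ∈ NS G ⁅ u ⁆ A) →
    nf u ∈ NS G ⁅ u ⁆ A × (∀ a → a ∈ NS G ⁅ u ⁆ A → w a ≤ w (nf u))

  IsN2Choice : Subset n → (Fin n → Fin n) → (Fin n → Fin n) → Set
  IsN2Choice A nf n₂ = ∀ u → 2 ℕ.≤ ∣ NS G ⁅ u ⁆ A ∣ →
    n₂ u ∈ NS G ⁅ u ⁆ A × n₂ u ≢ nf u
    × (∀ a → a ∈ NS G ⁅ u ⁆ A → a ≢ nf u → w a ≤ w (n₂ u))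

module Setup {n : ℕ} (G : Graph n) (w : Fin n → ℚ) (A : Subset n)
             (nf n₂ : Fin n → Fin n) (ε : ℚ) where
  open Graph G
  open Weights G w

  Nu : Fin n → Subset n
  Nu u = NS G ⁅ u ⁆ A

  contr : Fin n → Fin n → ℚ
  contr u v = if lookup (Nu u) v
              then 0ℚ ⊔ ((w u * w u - w² (Nu u ∖ₛ v)) ÷ₜ w v)
              else 0ℚ

  charge : Fin n → Fin n → ℚ
  charge u v = if ⌊ v FinP.≟ nf u ⌋ then w u - ½ * wS (Nu u) else 0ℚ

  CondA : Fin n → Fin n → Set
  CondA u v = v ≡ nf u × w (nf u) ≤ (1ℚ + ε) * w u × wS (Nu u ∖ₛ nf u) ≤ ε * w u

  CondB : Fin n → Fin n → Set
  CondB u v = 2 ℕ.≤ ∣ Nu u ∣ × (v ≡ nf u ⊎ v ≡ n₂ u)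
            × w (nf u) ÷ₜ (1ℚ + ε) ≤ w (n₂ u) × w (n₂ u) ≤ w (nf u)
            × w (nf u) ≤ (1ℚ + ε) * w u
            × wS (Nu u ─ (⁅ nf u ⁆ ∪ ⁅ n₂ u ⁆)) ≤ ε * w u

  Helpful : Fin n → Fin n → Set
  Helpful u v = u ∉ A × v ∈ A × adj u v ≡ true × (CondA u v ⊎ CondB u v)

  helpful? : ∀ u v → Dec (Helpful u v)
  helpful? u v = ¬? (u ∈? A) ×-dec ((v ∈? A) ×-dec ((adj u v Data.Bool.≟ true) ×-dec (condA? ⊎-dec condB?)))
    where
    condA? = (v FinP.≟ nf u) ×-dec ((w (nf u) ≤? (1ℚ + ε) * w u) ×-dec (wS (Nu u ∖ₛ nf u) ≤? ε * w u))
    condB? = (2 ℕ.≤? ∣ Nu u ∣) ×-dec (((v FinP.≟ nf u) ⊎-dec (v FinP.≟ n₂ u))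
             ×-dec ((w (nf u) ÷ₜ (1ℚ + ε) ≤? w (n₂ u)) ×-dec ((w (n₂ u) ≤? w (nf u))
             ×-dec ((w (nf u) ≤? (1ℚ + ε) * w u)
             ×-dec (wS (Nu u ─ (⁅ nf u ⁆ ∪ ⁅ n₂ u ⁆)) ≤? ε * w u)))))

  SpecialNeighbours : Fin n → Fin n → Set
  SpecialNeighbours u v = v ≡ nf u × ¬ Helpful u v × (+ 5 / 8) * w v < contr u v

  special? : ∀ u v → Dec (SpecialNeighbours u v)
  special? u v = (v FinP.≟ nf u) ×-dec (¬? (helpful? u v) ×-dec ((+ 5 / 8) * w v ℚP.<? contr u v))

  supp : Fin n → Subset n
  supp u = tabulate (λ v → lookup (Nu u) v ∧ ⌊ ¬? (helpful? u v) ⌋ ∧ ⌊ ¬? (special? u v) ⌋)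

record Constants (ε ξ : ℚ) : Set where
  private
    c : ℚ
    c = (+ 5 / 8) ÷ₜ (1ℚ - ε * ε)
    ε1 : ℚ
    ε1 = 1ℚ + ε
  field
    ε-pos : 0ℚ < ε
    ξ-pos : 0ℚ < ξ
    c1a : (+ 3 / 8) * (ε1 * ε1) + ε * ε ≤ (+ 11 / 16) * (ε1 * ε1) + ε * ε
    c1b : (+ 11 / 16) * (ε1 * ε1) + ε * ε ≤ (+ 3 / 4) * (ε1 * ε1) + ε * ε
    c1c : (+ 3 / 4) * (ε1 * ε1) + ε * ε ≤ 1ℚ
    c2a : (1ℚ - ε * ε1) * ½ ≤ (1ℚ - ε) * ½
    c2b : (1ℚ - (+ 2 / 1) * ε * ε1) * ½ ≤ (1ℚ - ε * ε1) * ½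
    c2c : ξ ≤ (1ℚ - (+ 2 / 1) * ε * ε1) * ½
    -- (1 - s)² / (1 + ε s) ≥ 2ξ  with  s = √c,  c = 5 / (8 (1 - ε²))
    c3-ε<1 : ε * ε < 1ℚ
    c3a : 0ℚ ≤ c + 1ℚ - (+ 2 / 1) * ξ
    c3b : ((+ 2 / 1) + (+ 2 / 1) * ξ * ε) * ((+ 2 / 1) + (+ 2 / 1) * ξ * ε) * c
          ≤ (c + 1ℚ - (+ 2 / 1) * ξ) * (c + 1ℚ - (+ 2 / 1) * ξ)
    c4a : ε ÷ₜ ((+ 4 / 1) * ((+ 2 / 1) + ε)) ≤ ε ÷ₜ ((+ 2 / 1) + ε)
    c4b : ε ÷ₜ ((+ 4 / 1) * ((+ 2 / 1) + ε)) ≤ + 1 / 4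
    c4c : ε ÷ₜ ((+ 4 / 1) * ((+ 2 / 1) + ε)) ≤ 1ℚ ÷ₜ ((+ 4 / 1) * ε1)
    c4d : ε ÷ₜ ((+ 4 / 1) * ((+ 2 / 1) + ε)) ≤ ε ÷ₜ ((+ 2 / 1) * ε1)
    c4e : ε ÷ₜ ((+ 4 / 1) * ((+ 2 / 1) + ε)) ≤ ε ÷ₜ ((+ 4 / 1) + (+ 2 / 1) * ε)
    c4f : ξ ≤ ε ÷ₜ ((+ 4 / 1) * ((+ 2 / 1) + ε))
    c5a : ε ÷ₜ ((+ 2 / 1) * (ε1 * ε1) * ((+ 2 / 1) + ε)) ≤ ε ÷ₜ ((+ 2 / 1) * ε1 * ((+ 2 / 1) + ε))
    c5b : ε ÷ₜ ((+ 2 / 1) * (ε1 * ε1 * ε1) * ((+ 2 / 1) + ε)) ≤ ε ÷ₜ ((+ 2 / 1) * (ε1 * ε1) * ((+ 2 / 1) + ε))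
    c5c : ξ ≤ ε ÷ₜ ((+ 2 / 1) * (ε1 * ε1 * ε1) * ((+ 2 / 1) + ε))
    c6 : ξ ≤ ((+ 1 / 3 - ε) * (+ 1 / 3 - ε)) ÷ₜ (((+ 4 / 3) + (+ 2 / 1) * ε) * ((+ 2 / 1) + ε))
    c7 : (+ 2 / 1) * ξ ≤ ε * ((((+ 2 / 1) + 1ℚ ÷ₜ ε1) ÷ₜ ((+ 2 / 1) + ε)) - ε1)

-- Since N(u, A) = {a} with a = n(u), contr(u, a) = w(u)² / w(a) and charge(u, a) = w(u) − w(a) / 2,
-- so the left factor times w(a) is the perfect square (w(a) − w(u))², while supp(u) ⊆ {a}.
-- If a ∈ supp(u), then a ∉ help(u) and u, a are not special neighbours, so
-- w(u)² ≤ (5/8) w(a)² ≤ c w(a)² with c = 5 / (8 (1 − ε²)); the constraint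
-- (1 − √c)² ≥ 2ξ (1 + ε √c) ≥ 2ξ on the constants then gives (w(a) − w(u))² ≥ 2ξ w(a)².

module Submission where

open import Data.Bool using (true; false; _∧_; if_then_else_)
open import Data.Bool.Properties using (∧-conicalˡ)
open import Data.Fin using (Fin; zero; suc)
import Data.Fin.Properties as Fin
open import Data.Fin.Subset
  using (Subset; _∈_; _∉_; _⊆_; ⁅_⁆; ⊥; ∣_∣; inside; outside) renaming (_-_ to _∖ₛ_)
open import Data.Fin.Subset.Properties
  using (∉⊥; x∈⁅x⁆; x∈⁅y⁆⇒x≡y; x≢y⇒x∉⁅y⁆; drop-∷-⊆; Empty-unique; p─⊥≡p)
open import Data.Integer using (+_)
open import Data.List using (_∷_; [])
open import Data.Nat as ℕ using (ℕ)
open import Data.Nat.Properties using (suc-injective)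
open import Data.Product using (∃; _×_; _,_; proj₁)
open import Data.Rational hiding (∣_∣; floor)
open import Data.Rational.Properties
open import Data.Sum using (_⊎_; inj₁; inj₂)
import Data.Sum as Sum
open import Data.Vec as Vec using (lookup; here)
open import Data.Vec.Properties using (lookup∘tabulate; []=⇒lookup; lookup⇒[]=)
open import Function using (_∘_)
open import Relation.Binary.PropositionalEquality
open import Relation.Nullary using (¬_; Dec; yes; no; contradiction)
open import Relation.Nullary.Decidable using (⌊_⌋; ¬?; isYes≗does; dec-true; dec⇒maybe)
open import Tactic.RingSolver using (solve)
open import Tactic.RingSolver.Core.AlmostCommutativeRing
  using (AlmostCommutativeRing; fromCommutativeRing)

open import Defs

ℚ-ring : AlmostCommutativeRing _ _
ℚ-ring = fromCommutativeRing +-*-commutativeRing (λ p → dec⇒maybe (0ℚ ≟ p))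

0≤q-p⇒p≤q : ∀ {p q} → 0ℚ ≤ q - p → p ≤ q
0≤q-p⇒p≤q {p} {q} 0≤q-p = begin
  p          ≡⟨ sym (+-identityˡ p) ⟩
  0ℚ + p     ≤⟨ +-monoˡ-≤ p 0≤q-p ⟩
  q - p + p  ≡⟨ solve (q ∷ p ∷ []) ℚ-ring ⟩
  q          ∎
  where open ≤-Reasoning

p≤q⇒0≤q-p : ∀ {p q} → p ≤ q → 0ℚ ≤ q - p
p≤q⇒0≤q-p {p} {q} p≤q = begin
  0ℚ     ≡⟨ sym (+-inverseʳ p) ⟩
  p - p  ≤⟨ +-monoˡ-≤ (- p) p≤q ⟩
  q - p  ∎
  where open ≤-Reasoning

p<q⇒0<q-p : ∀ {p q} → p < q → 0ℚ < q - p
p<q⇒0<q-p {p} {q} p<q = begin-strict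
  0ℚ     ≡⟨ sym (+-inverseʳ p) ⟩
  p - p  <⟨ +-monoˡ-< (- p) p<q ⟩
  q - p  ∎
  where open ≤-Reasoning

0≤p*q : ∀ {p q} → 0ℚ ≤ p → 0ℚ ≤ q → 0ℚ ≤ p * q
0≤p*q {p} {q} 0≤p 0≤q =
  nonNegative⁻¹ _ {{nonNeg*nonNeg⇒nonNeg p {{nonNegative 0≤p}} q {{nonNegative 0≤q}}}}

0≤p*p : ∀ p → 0ℚ ≤ p * p
0≤p*p p with ≤-total 0ℚ p
... | inj₁ 0≤p = 0≤p*q 0≤p 0≤p
... | inj₂ p≤0 =
  nonNegative⁻¹ _ {{nonPos*nonPos⇒nonPos p {{nonPositive p≤0}} p {{nonPositive p≤0}}}}

p*p≤q*q⇒p≤q : ∀ {p q} → 0ℚ ≤ q → p * p ≤ q * q → p ≤ q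
p*p≤q*q⇒p≤q {p} {q} 0≤q p*p≤q*q with p ≤? q
... | yes p≤q = p≤q
... | no p≰q = contradiction (<-≤-trans q*q<p*p p*p≤q*q) (<-irrefl refl)
  where
  q<p = ≰⇒> p≰q
  q*q<p*p : q * q < p * p
  q*q<p*p = begin-strict
    q * q  ≤⟨ *-monoʳ-≤-nonNeg q {{nonNegative 0≤q}} (<⇒≤ q<p) ⟩
    p * q  <⟨ *-monoʳ-<-pos p {{positive (≤-<-trans 0≤q q<p)}} q<p ⟩
    p * p  ∎
    where open ≤-Reasoning

4≤[2+p]² : ∀ {p} → 0ℚ ≤ p → + 4 / 1 ≤ ((+ 2 / 1) + p) * ((+ 2 / 1) + p)
4≤[2+p]² {p} 0≤p =
  0≤q-p⇒p≤q (subst (0ℚ ≤_) slack≡ (0≤p*q 0≤p (+-mono-≤ (nonNegative⁻¹ (+ 4 / 1)) 0≤p)))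
  where
  slack≡ : p * ((+ 4 / 1) + p) ≡ ((+ 2 / 1) + p) * ((+ 2 / 1) + p) - + 4 / 1
  slack≡ = solve (p ∷ []) ℚ-ring

p÷ₜq*q≡p : ∀ p {q} → 0ℚ < q → (p ÷ₜ q) * q ≡ p
p÷ₜq*q≡p p {q} 0<q with q ≟ 0ℚ
... | yes refl = contradiction 0<q (<-irrefl refl)
... | no q≢0 = begin
  p * 1/ q * q    ≡⟨ *-assoc p (1/ q) q ⟩
  p * (1/ q * q)  ≡⟨ cong (p *_) (*-inverseˡ q) ⟩
  p * 1ℚ          ≡⟨ *-identityʳ p ⟩
  p               ∎
  where
  open ≡-Reasoning
  instance _ = ≢-nonZero q≢0

0≤p÷ₜq : ∀ {p q} → 0ℚ ≤ p → 0ℚ < q → 0ℚ ≤ p ÷ₜ q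
0≤p÷ₜq {p} {q} 0≤p 0<q with q ≟ 0ℚ
... | yes refl = ≤-refl
... | no q≢0 = 0≤p*q 0≤p (<⇒≤ (positive⁻¹ _ {{1/pos⇒pos q {{positive 0<q}}}}))

p÷ₜq≤1 : ∀ {p q} → 0ℚ < q → p ≤ q → p ÷ₜ q ≤ 1ℚ
p÷ₜq≤1 {p} {q} 0<q p≤q = *-cancelʳ-≤-pos q {{positive 0<q}} (begin
  p ÷ₜ q * q  ≡⟨ p÷ₜq*q≡p p 0<q ⟩
  p           ≤⟨ p≤q ⟩
  q           ≡⟨ sym (*-identityˡ q) ⟩
  1ℚ * q      ∎)
  where open ≤-Reasoning

p≤p÷ₜq : ∀ {p q} → 0ℚ ≤ p → 0ℚ < q → q ≤ 1ℚ → p ≤ p ÷ₜ q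
p≤p÷ₜq {p} {q} 0≤p 0<q q≤1 = begin
  p               ≡⟨ sym (p÷ₜq*q≡p p 0<q) ⟩
  p ÷ₜ q * q      ≤⟨ *-monoˡ-≤-nonNeg (p ÷ₜ q) {{nonNegative (0≤p÷ₜq 0≤p 0<q)}} q≤1 ⟩
  p ÷ₜ q * 1ℚ     ≡⟨ *-identityʳ (p ÷ₜ q) ⟩
  p ÷ₜ q          ∎
  where open ≤-Reasoning

-- Square-root-free form of (W − x)² ≥ (1 − √c)² W² ≥ (1 + c − D) W²
-- for x ≤ √c W and 2√c ≤ D ≤ 2.
square-gap : ∀ {c D x W} → 0ℚ ≤ D → D ≤ + 2 / 1 → (+ 4 / 1) * c ≤ D * D →
             0ℚ ≤ x → 0ℚ ≤ W → x * x ≤ c * (W * W) →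
             (1ℚ + c - D) * (W * W) ≤ (W - x) * (W - x)
square-gap {c} {D} {x} {W} 0≤D D≤2 4c≤D² 0≤x 0≤W x²≤cW² =
  0≤q-p⇒p≤q (subst (0ℚ ≤_) gap≡ (p≤q⇒0≤q-p cW²-x²≤WΔ))
  where
  open ≤-Reasoning
  4cW²≤D²W² : (+ 4 / 1) * c * (W * W) ≤ D * D * (W * W)
  4cW²≤D²W² = *-monoʳ-≤-nonNeg (W * W) {{nonNegative (0≤p*q 0≤W 0≤W)}} 4c≤D²
  2x≤DW : (+ 2 / 1) * x ≤ D * W
  2x≤DW = p*p≤q*q⇒p≤q (0≤p*q 0≤D 0≤W) (begin
    (+ 2 / 1) * x * ((+ 2 / 1) * x)  ≡⟨ solve (x ∷ []) ℚ-ring ⟩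
    (+ 4 / 1) * (x * x)              ≤⟨ *-monoˡ-≤-nonNeg (+ 4 / 1) x²≤cW² ⟩
    (+ 4 / 1) * (c * (W * W))        ≡⟨ solve (c ∷ W ∷ []) ℚ-ring ⟩
    (+ 4 / 1) * c * (W * W)          ≤⟨ 4cW²≤D²W² ⟩
    D * D * (W * W)                  ≡⟨ solve (D ∷ W ∷ []) ℚ-ring ⟩
    D * W * (D * W)                  ∎)
  0≤Δ : 0ℚ ≤ D * W - (+ 2 / 1) * x
  0≤Δ = p≤q⇒0≤q-p 2x≤DW
  DW+2x≤4W : D * W + (+ 2 / 1) * x ≤ (+ 4 / 1) * W
  DW+2x≤4W = 0≤q-p⇒p≤q (subst (0ℚ ≤_) slack≡
    (+-mono-≤ (0≤p*q (p≤q⇒0≤q-p D≤2) (+-mono-≤ 0≤W 0≤W)) 0≤Δ))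
    where
    slack≡ : (+ 2 / 1 - D) * (W + W) + (D * W - (+ 2 / 1) * x)
             ≡ (+ 4 / 1) * W - (D * W + (+ 2 / 1) * x)
    slack≡ = solve (D ∷ x ∷ W ∷ []) ℚ-ring
  cW²-x²≤WΔ : c * (W * W) - x * x ≤ W * (D * W - (+ 2 / 1) * x)
  cW²-x²≤WΔ = *-cancelˡ-≤-pos (+ 4 / 1) (begin
    (+ 4 / 1) * (c * (W * W) - x * x)
      ≡⟨ solve (c ∷ x ∷ W ∷ []) ℚ-ring ⟩
    (+ 4 / 1) * c * (W * W) - (+ 2 / 1) * x * ((+ 2 / 1) * x)
      ≤⟨ +-monoˡ-≤ (- ((+ 2 / 1) * x * ((+ 2 / 1) * x))) 4cW²≤D²W² ⟩
    D * D * (W * W) - (+ 2 / 1) * x * ((+ 2 / 1) * x)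
      ≡⟨ solve (D ∷ x ∷ W ∷ []) ℚ-ring ⟩
    (D * W - (+ 2 / 1) * x) * (D * W + (+ 2 / 1) * x)
      ≤⟨ *-monoˡ-≤-nonNeg (D * W - (+ 2 / 1) * x) {{nonNegative 0≤Δ}} DW+2x≤4W ⟩
    (D * W - (+ 2 / 1) * x) * ((+ 4 / 1) * W)
      ≡⟨ solve (D ∷ x ∷ W ∷ []) ℚ-ring ⟩
    (+ 4 / 1) * (W * (D * W - (+ 2 / 1) * x))  ∎)
  gap≡ : W * (D * W - (+ 2 / 1) * x) - (c * (W * W) - x * x)
         ≡ (W - x) * (W - x) - (1ℚ + c - D) * (W * W)
  gap≡ = solve (c ∷ D ∷ x ∷ W ∷ []) ℚ-ring

perfect-square : ∀ {t x W} → t * W ≡ x * x →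
                 (t - (+ 2 / 1) * (x - ½ * W)) * W ≡ (W - x) * (W - x)
perfect-square {t} {x} {W} tW≡x² = begin
  (t - (+ 2 / 1) * (x - ½ * W)) * W  ≡⟨ solve (t ∷ x ∷ W ∷ []) ℚ-ring ⟩
  t * W - (+ 2 / 1) * x * W + W * W  ≡⟨ cong (λ s → s - (+ 2 / 1) * x * W + W * W) tW≡x² ⟩
  x * x - (+ 2 / 1) * x * W + W * W  ≡⟨ solve (x ∷ W ∷ []) ℚ-ring ⟩
  (W - x) * (W - x)                  ∎
  where open ≡-Reasoning

5/8≤1-ε² : ∀ {ε ξ} → Constants ε ξ → + 5 / 8 ≤ 1ℚ - ε * ε
5/8≤1-ε² {ε} K = 0≤q-p⇒p≤q (subst (0ℚ ≤_) slack≡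
  (+-mono-≤ (+-mono-≤ (p≤q⇒0≤q-p c1c) (0≤p*q (nonNegative⁻¹ (+ 3 / 4)) 0≤ε[2+ε]))
            (nonNegative⁻¹ (+ 1 / 8))))
  where
  open Constants K
  0≤ε[2+ε] : 0ℚ ≤ ε * ((+ 2 / 1) + ε)
  0≤ε[2+ε] = 0≤p*q (<⇒≤ ε-pos) (+-mono-≤ (nonNegative⁻¹ (+ 2 / 1)) (<⇒≤ ε-pos))
  slack≡ : 1ℚ - ((+ 3 / 4) * ((1ℚ + ε) * (1ℚ + ε)) + ε * ε)
             + (+ 3 / 4) * (ε * ((+ 2 / 1) + ε)) + + 1 / 8
           ≡ 1ℚ - ε * ε - + 5 / 8
  slack≡ = solve (ε ∷ []) ℚ-ring

-- c is the square of the threshold √(5 / (8 (1 − ε²))); the fields c3a and c3b are the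
-- constraint (1 − √c)² ≥ 2ξ (1 + ε √c) squared out, i.e. D ≥ (2 + 2ξε) √c with D = c + 1 − 2ξ.
five-eighths-gap : ∀ {ε ξ x W} → Constants ε ξ → 0ℚ ≤ x → 0ℚ ≤ W →
                   x * x ≤ (+ 5 / 8) * (W * W) →
                   (+ 2 / 1) * ξ * W * W ≤ (W - x) * (W - x)
five-eighths-gap {ε} {ξ} {x} {W} K 0≤x 0≤W x²≤5/8W² =
  subst (_≤ (W - x) * (W - x)) (D-cancel c)
    (square-gap {c = c} c3a D≤2 4c≤D² 0≤x 0≤W x²≤cW²)
  where
  open Constants K
  open ≤-Reasoning
  q c : ℚ
  q = 1ℚ - ε * ε
  c = (+ 5 / 8) ÷ₜ q
  0<q : 0ℚ < q
  0<q = p<q⇒0<q-p c3-ε<1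
  q≤1 : q ≤ 1ℚ
  q≤1 = 0≤q-p⇒p≤q (subst (0ℚ ≤_) (ε²≡1-q ε) (0≤p*p ε))
    where
    ε²≡1-q : ∀ ε → ε * ε ≡ 1ℚ - (1ℚ - ε * ε)
    ε²≡1-q ε = solve (ε ∷ []) ℚ-ring
  0≤c : 0ℚ ≤ c
  0≤c = 0≤p÷ₜq (nonNegative⁻¹ (+ 5 / 8)) 0<q
  D≤2 : c + 1ℚ - (+ 2 / 1) * ξ ≤ + 2 / 1
  D≤2 = begin
    c + 1ℚ - (+ 2 / 1) * ξ
      ≤⟨ +-monoʳ-≤ (c + 1ℚ) (neg-antimono-≤ (0≤p*q (nonNegative⁻¹ (+ 2 / 1)) (<⇒≤ ξ-pos))) ⟩
    c + 1ℚ - 0ℚ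
      ≤⟨ +-monoˡ-≤ (- 0ℚ) (+-monoˡ-≤ 1ℚ (p÷ₜq≤1 0<q (5/8≤1-ε² K))) ⟩
    1ℚ + 1ℚ - 0ℚ
      ≡⟨⟩
    + 2 / 1  ∎
  4c≤D² : (+ 4 / 1) * c ≤ (c + 1ℚ - (+ 2 / 1) * ξ) * (c + 1ℚ - (+ 2 / 1) * ξ)
  4c≤D² = ≤-trans (*-monoʳ-≤-nonNeg c {{nonNegative 0≤c}} (4≤[2+p]² 0≤2ξε)) c3b
    where
    0≤2ξε : 0ℚ ≤ (+ 2 / 1) * ξ * ε
    0≤2ξε = 0≤p*q (0≤p*q (nonNegative⁻¹ (+ 2 / 1)) (<⇒≤ ξ-pos)) (<⇒≤ ε-pos)
  x²≤cW² : x * x ≤ c * (W * W)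
  x²≤cW² = ≤-trans x²≤5/8W² (*-monoʳ-≤-nonNeg (W * W) {{nonNegative (0≤p*q 0≤W 0≤W)}}
                                (p≤p÷ₜq (nonNegative⁻¹ (+ 5 / 8)) 0<q q≤1))
  D-cancel : ∀ c → (1ℚ + c - (c + 1ℚ - (+ 2 / 1) * ξ)) * (W * W) ≡ (+ 2 / 1) * ξ * W * W
  D-cancel c = solve (c ∷ ξ ∷ W ∷ []) ℚ-ring

∣p∣≡0⇒p≡⊥ : ∀ {n} {p : Subset n} → ∣ p ∣ ≡ 0 → p ≡ ⊥
∣p∣≡0⇒p≡⊥ {p = Vec.[]}          _ = refl
∣p∣≡0⇒p≡⊥ {p = outside Vec.∷ p} h = cong (outside Vec.∷_) (∣p∣≡0⇒p≡⊥ h)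

∣p∣≡1⇒p≡⁅x⁆ : ∀ {n} {p : Subset n} → ∣ p ∣ ≡ 1 → ∃ λ x → p ≡ ⁅ x ⁆
∣p∣≡1⇒p≡⁅x⁆ {p = inside Vec.∷ p}  h =
  zero , cong (inside Vec.∷_) (∣p∣≡0⇒p≡⊥ (suc-injective h))
∣p∣≡1⇒p≡⁅x⁆ {p = outside Vec.∷ p} h with ∣p∣≡1⇒p≡⁅x⁆ h
... | x , p≡⁅x⁆ = suc x , cong (outside Vec.∷_) p≡⁅x⁆

p⊆⁅x⁆⇒p≡⊥⊎p≡⁅x⁆ : ∀ {n} {p : Subset n} (x : Fin n) →
                   p ⊆ ⁅ x ⁆ → p ≡ ⊥ ⊎ p ≡ ⁅ x ⁆
p⊆⁅x⁆⇒p≡⊥⊎p≡⁅x⁆ {p = s Vec.∷ p} zero s∷p⊆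
  with s | Empty-unique {p = p} (λ (y , y∈p) → ∉⊥ (drop-∷-⊆ s∷p⊆ y∈p))
... | outside | p≡⊥ = inj₁ (cong (outside Vec.∷_) p≡⊥)
... | inside  | p≡⊥ = inj₂ (cong (inside Vec.∷_) p≡⊥)
p⊆⁅x⁆⇒p≡⊥⊎p≡⁅x⁆ {p = outside Vec.∷ p} (suc x) p⊆ =
  Sum.map (cong (outside Vec.∷_)) (cong (outside Vec.∷_)) (p⊆⁅x⁆⇒p≡⊥⊎p≡⁅x⁆ x (drop-∷-⊆ p⊆))
p⊆⁅x⁆⇒p≡⊥⊎p≡⁅x⁆ {p = inside Vec.∷ p} (suc x) p⊆ with p⊆ here
... | ()

⁅x⁆∖ₛx≡⊥ : ∀ {n} (x : Fin n) → ⁅ x ⁆ ∖ₛ x ≡ ⊥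
⁅x⁆∖ₛx≡⊥ zero    = cong (outside Vec.∷_) (p─⊥≡p ⊥)
⁅x⁆∖ₛx≡⊥ (suc x) = cong (outside Vec.∷_) (⁅x⁆∖ₛx≡⊥ x)

module _ {n} {p : Subset n} {x : Fin n} {A : Set} {t e : A} where

  if-∈ : x ∈ p → (if lookup p x then t else e) ≡ t
  if-∈ x∈p rewrite []=⇒lookup x∈p = refl

  if-∉ : x ∉ p → (if lookup p x then t else e) ≡ e
  if-∉ x∉p with lookup p x in eq
  ... | true  = contradiction (lookup⇒[]= x p eq) x∉p
  ... | false = refl

sumFin-zero : ∀ {n} (f : Fin n → ℚ) → (∀ i → f i ≡ 0ℚ) → sumFin f ≡ 0ℚ
sumFin-zero {ℕ.zero}  f f≡0 = refl
sumFin-zero {ℕ.suc n} f f≡0 = cong₂ _+_ (f≡0 zero) (sumFin-zero (f ∘ suc) (f≡0 ∘ suc))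

sumFin-single : ∀ {n} (f : Fin n → ℚ) (a : Fin n) →
                (∀ i → i ≢ a → f i ≡ 0ℚ) → sumFin f ≡ f a
sumFin-single f zero f≡0 = begin
  f zero + sumFin (f ∘ suc)
    ≡⟨ cong (_+_ (f zero)) (sumFin-zero (f ∘ suc) (λ i → f≡0 (suc i) λ ())) ⟩
  f zero + 0ℚ
    ≡⟨ +-identityʳ (f zero) ⟩
  f zero  ∎
  where open ≡-Reasoning
sumFin-single f (suc a) f≡0 = begin
  f zero + sumFin (f ∘ suc)
    ≡⟨ cong₂ _+_ (f≡0 zero λ ())
                 (sumFin-single (f ∘ suc) a (λ i i≢a → f≡0 (suc i) (i≢a ∘ Fin.suc-injective))) ⟩
  0ℚ + f (suc a)
    ≡⟨ +-identityˡ (f (suc a)) ⟩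
  f (suc a)  ∎
  where open ≡-Reasoning

sumOver-⊥ : ∀ {n} (f : Fin n → ℚ) → sumOver ⊥ f ≡ 0ℚ
sumOver-⊥ f = sumFin-zero _ (λ i → if-∉ {p = ⊥} {x = i} {t = f i} ∉⊥)

sumOver-single : ∀ {n} {X : Subset n} {a} (f : Fin n → ℚ) → a ∈ X →
                 (∀ i → i ≢ a → i ∈ X → f i ≡ 0ℚ) → sumOver X f ≡ f a
sumOver-single {X = X} {a} f a∈X f≡0 = trans (sumFin-single _ a vanish) (if-∈ a∈X)
  where
  vanish : ∀ i → i ≢ a → (if lookup X i then f i else 0ℚ) ≡ 0ℚ
  vanish i i≢a with lookup X i in eq
  ... | true  = f≡0 i i≢a (lookup⇒[]= i X eq)
  ... | false = refl

sumOver-⁅⁆ : ∀ {n} (f : Fin n → ℚ) (a : Fin n) → sumOver ⁅ a ⁆ f ≡ f a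
sumOver-⁅⁆ f a =
  sumOver-single f (x∈⁅x⁆ a) (λ i i≢a i∈⁅a⁆ → contradiction (x∈⁅y⁆⇒x≡y a i∈⁅a⁆) i≢a)

module SetupProperties {n} (G : Graph n) (w : Fin n → ℚ) (A : Subset n)
                       (nf n₂ : Fin n → Fin n) (ε : ℚ) where
  open Setup G w A nf n₂ ε
  open Weights G w

  Nu⊆A : ∀ u → Nu u ⊆ A
  Nu⊆A u {v} v∈Nu =
    lookup⇒[]= v A (∧-conicalˡ _ _ (trans (sym (lookup∘tabulate _ v)) ([]=⇒lookup v∈Nu)))

  ∣Nu∣≡1⇒Nu≡⁅nf⁆ : IsNChoice A nf → ∀ u → ∣ Nu u ∣ ≡ 1 → Nu u ≡ ⁅ nf u ⁆
  ∣Nu∣≡1⇒Nu≡⁅nf⁆ isN u ∣Nu∣≡1 with ∣p∣≡1⇒p≡⁅x⁆ ∣Nu∣≡1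
  ... | x , Nu≡⁅x⁆ = trans Nu≡⁅x⁆ (cong ⁅_⁆ (sym nf≡x))
    where
    x∈Nu : x ∈ Nu u
    x∈Nu = subst (x ∈_) (sym Nu≡⁅x⁆) (x∈⁅x⁆ x)
    nf≡x : nf u ≡ x
    nf≡x = x∈⁅y⁆⇒x≡y x (subst (nf u ∈_) Nu≡⁅x⁆ (proj₁ (isN u (x , x∈Nu))))

  ∈supp⁻ : ∀ {u v} → v ∈ supp u → v ∈ Nu u × ¬ Helpful u v × ¬ SpecialNeighbours u v
  ∈supp⁻ {u} {v} v∈supp with unpack (lookup (Nu u) v) (helpful? u v) (special? u v)
                               (trans (sym (lookup∘tabulate _ v)) ([]=⇒lookup v∈supp))
    where
    unpack : ∀ b {P Q : Set} (p? : Dec P) (q? : Dec Q) →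
             b ∧ ⌊ ¬? p? ⌋ ∧ ⌊ ¬? q? ⌋ ≡ true → b ≡ true × ¬ P × ¬ Q
    unpack true  (no ¬p) (no ¬q) _ = refl , ¬p , ¬q
    unpack true  (yes _) _       ()
    unpack true  (no _)  (yes _) ()
    unpack false _       _       ()
  ... | v∈Nu , ¬helpful , ¬special = lookup⇒[]= v (Nu u) v∈Nu , ¬helpful , ¬special

  nf∈supp⇒contr≤5/8w : ∀ u → nf u ∈ supp u → contr u (nf u) ≤ (+ 5 / 8) * w (nf u)
  nf∈supp⇒contr≤5/8w u nf∈supp with ∈supp⁻ nf∈supp
  ... | _ , ¬helpful , ¬special = ≮⇒≥ (λ 5/8w<contr → ¬special (refl , ¬helpful , 5/8w<contr))

  module SingleNeighbour {u} (Nu≡⁅nf⁆ : Nu u ≡ ⁅ nf u ⁆) where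

    nf∈Nu : nf u ∈ Nu u
    nf∈Nu = subst (nf u ∈_) (sym Nu≡⁅nf⁆) (x∈⁅x⁆ (nf u))

    ≢nf⇒∉Nu : ∀ {v} → v ≢ nf u → v ∉ Nu u
    ≢nf⇒∉Nu v≢nf = subst (_ ∉_) (sym Nu≡⁅nf⁆) (x≢y⇒x∉⁅y⁆ v≢nf)

    w²[Nu∖ₛnf]≡0 : w² (Nu u ∖ₛ nf u) ≡ 0ℚ
    w²[Nu∖ₛnf]≡0 = begin
      w² (Nu u ∖ₛ nf u)        ≡⟨ cong (λ X → w² (X ∖ₛ nf u)) Nu≡⁅nf⁆ ⟩
      w² (⁅ nf u ⁆ ∖ₛ nf u)    ≡⟨ cong w² (⁅x⁆∖ₛx≡⊥ (nf u)) ⟩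
      w² ⊥                     ≡⟨ sumOver-⊥ (λ v → w v * w v) ⟩
      0ℚ                       ∎
      where open ≡-Reasoning

    contr-nf : 0ℚ < w (nf u) → contr u (nf u) ≡ (w u * w u) ÷ₜ w (nf u)
    contr-nf 0<W = begin
      contr u (nf u)
        ≡⟨ if-∈ nf∈Nu ⟩
      0ℚ ⊔ ((w u * w u - w² (Nu u ∖ₛ nf u)) ÷ₜ w (nf u))
        ≡⟨ cong (λ s → 0ℚ ⊔ ((w u * w u - s) ÷ₜ w (nf u))) w²[Nu∖ₛnf]≡0 ⟩
      0ℚ ⊔ ((w u * w u - 0ℚ) ÷ₜ w (nf u))
        ≡⟨ cong (λ s → 0ℚ ⊔ (s ÷ₜ w (nf u))) (+-identityʳ (w u * w u)) ⟩
      0ℚ ⊔ ((w u * w u) ÷ₜ w (nf u))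
        ≡⟨ p≤q⇒p⊔q≡q (0≤p÷ₜq (0≤p*p (w u)) 0<W) ⟩
      (w u * w u) ÷ₜ w (nf u)  ∎
      where open ≡-Reasoning

    sumOver-contr : 0ℚ < w (nf u) → sumOver A (contr u) ≡ (w u * w u) ÷ₜ w (nf u)
    sumOver-contr 0<W =
      trans (sumOver-single (contr u) (Nu⊆A u nf∈Nu) (λ v v≢nf _ → if-∉ (≢nf⇒∉Nu v≢nf)))
            (contr-nf 0<W)

    charge-nf : charge u (nf u) ≡ w u - ½ * w (nf u)
    charge-nf = begin
      charge u (nf u)         ≡⟨ cong (λ b → if b then w u - ½ * wS (Nu u) else 0ℚ) nf≟nf ⟩
      w u - ½ * wS (Nu u)     ≡⟨ cong (λ X → w u - ½ * wS X) Nu≡⁅nf⁆ ⟩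
      w u - ½ * wS ⁅ nf u ⁆   ≡⟨ cong (λ s → w u - ½ * s) (sumOver-⁅⁆ w (nf u)) ⟩
      w u - ½ * w (nf u)      ∎
      where
      open ≡-Reasoning
      nf≟nf : ⌊ nf u Fin.≟ nf u ⌋ ≡ true
      nf≟nf = trans (isYes≗does (nf u Fin.≟ nf u)) (dec-true (nf u Fin.≟ nf u) refl)

    supp≡⊥⊎supp≡⁅nf⁆ : supp u ≡ ⊥ ⊎ supp u ≡ ⁅ nf u ⁆
    supp≡⊥⊎supp≡⁅nf⁆ =
      p⊆⁅x⁆⇒p≡⊥⊎p≡⁅x⁆ (nf u)
        (λ v∈supp → subst (_ ∈_) Nu≡⁅nf⁆ (proj₁ (∈supp⁻ v∈supp)))

    surplus≡ : 0ℚ < w (nf u) →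
               (sumOver A (contr u) - (+ 2 / 1) * charge u (nf u)) * w (nf u)
               ≡ (w (nf u) - w u) * (w (nf u) - w u)
    surplus≡ 0<W =
      trans (cong₂ (λ s c → (s - (+ 2 / 1) * c) * w (nf u)) (sumOver-contr 0<W) charge-nf)
            (perfect-square {t = (w u * w u) ÷ₜ w (nf u)} (p÷ₜq*q≡p (w u * w u) 0<W))

    nf∈supp⇒w²≤5/8w² : 0ℚ < w (nf u) → nf u ∈ supp u →
                        w u * w u ≤ (+ 5 / 8) * (w (nf u) * w (nf u))
    nf∈supp⇒w²≤5/8w² 0<W nf∈supp = begin
      w u * w u                           ≡⟨ sym (p÷ₜq*q≡p (w u * w u) 0<W) ⟩
      (w u * w u) ÷ₜ W * W                ≡⟨ cong (_* W) (sym (contr-nf 0<W)) ⟩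
      contr u (nf u) * W
        ≤⟨ *-monoʳ-≤-nonNeg W {{nonNegative (<⇒≤ 0<W)}} (nf∈supp⇒contr≤5/8w u nf∈supp) ⟩
      (+ 5 / 8) * W * W                   ≡⟨ *-assoc (+ 5 / 8) W W ⟩
      (+ 5 / 8) * (W * W)                 ∎
      where
      open ≤-Reasoning
      W : ℚ
      W = w (nf u)

    scaled-wS-supp≤square : ∀ {ξ} → Constants ε ξ → 0ℚ < w u → 0ℚ < w (nf u) →
                            (+ 2 / 1) * ξ * w (nf u) * wS (supp u) ≤ (w (nf u) - w u) * (w (nf u) - w u)
    scaled-wS-supp≤square {ξ} K 0<x 0<W with supp≡⊥⊎supp≡⁅nf⁆
    ... | inj₁ supp≡⊥ = begin
      (+ 2 / 1) * ξ * W * wS (supp u)  ≡⟨ cong (λ X → (+ 2 / 1) * ξ * W * wS X) supp≡⊥ ⟩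
      (+ 2 / 1) * ξ * W * wS ⊥         ≡⟨ cong ((+ 2 / 1) * ξ * W *_) (sumOver-⊥ w) ⟩
      (+ 2 / 1) * ξ * W * 0ℚ           ≡⟨ *-zeroʳ ((+ 2 / 1) * ξ * W) ⟩
      0ℚ                               ≤⟨ 0≤p*p (W - w u) ⟩
      (W - w u) * (W - w u)            ∎
      where
      open ≤-Reasoning
      W : ℚ
      W = w (nf u)
    ... | inj₂ supp≡⁅nf⁆ = begin
      (+ 2 / 1) * ξ * W * wS (supp u)  ≡⟨ cong (λ X → (+ 2 / 1) * ξ * W * wS X) supp≡⁅nf⁆ ⟩
      (+ 2 / 1) * ξ * W * wS ⁅ nf u ⁆  ≡⟨ cong ((+ 2 / 1) * ξ * W *_) (sumOver-⁅⁆ w (nf u)) ⟩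
      (+ 2 / 1) * ξ * W * W
        ≤⟨ five-eighths-gap K (<⇒≤ 0<x) (<⇒≤ 0<W) (nf∈supp⇒w²≤5/8w² 0<W nf∈supp) ⟩
      (W - w u) * (W - w u)            ∎
      where
      open ≤-Reasoning
      W : ℚ
      W = w (nf u)
      nf∈supp : nf u ∈ supp u
      nf∈supp = subst (nf u ∈_) (sym supp≡⁅nf⁆) (x∈⁅x⁆ (nf u))


corollary1 : (k : ℕ) → 4 ℕ.≤ k →
    {n : ℕ} (G : Graph n) → ClawFree G (ℕ.suc k) →
    (w : Fin n → ℚ) → (∀ v → 0ℚ < w v) →
    (A* A : Subset n) →
    Weights.MaxWeightIndependent G w A* →
    Independent G A →
    (∀ X → ¬ Weights.ClawShapedImprovement G w A X) →
    (nf n₂ : Fin n → Fin n) →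
    Weights.IsNChoice G w A nf →
    Weights.IsN2Choice G w A nf n₂ →
    (ε ξ : ℚ) → Constants ε ξ →
    (u : Fin n) → u ∈ A* → ∣ Setup.Nu G w A nf n₂ ε u ∣ ≡ 1 →
    _≤_
      ((+ 2 / 1) * ξ * w (nf u) * Weights.wS G w (Setup.supp G w A nf n₂ ε u))
      ((sumOver A (Setup.contr G w A nf n₂ ε u)
          - (+ 2 / 1) * Setup.charge G w A nf n₂ ε u (nf u))
        * w (nf u))
corollary1 _ _ G _ w 0<w _ A _ _ _ nf n₂ isN _ ε ξ K u _ ∣Nu∣≡1 = begin
  (+ 2 / 1) * ξ * W * wS (supp u)                          ≤⟨ scaled-wS-supp≤square K (0<w u) 0<W ⟩
  (W - w u) * (W - w u)                                    ≡⟨ sym (surplus≡ 0<W) ⟩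
  (sumOver A (contr u) - (+ 2 / 1) * charge u (nf u)) * W  ∎
  where
  open Setup G w A nf n₂ ε
  open Weights G w
  open SetupProperties G w A nf n₂ ε
  open SingleNeighbour (∣Nu∣≡1⇒Nu≡⁅nf⁆ isN u ∣Nu∣≡1)
  open ≤-Reasoning
  W : ℚ
  W = w (nf u)
  0<W : 0ℚ < W
  0<W = 0<w (nf u)
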